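{- For all multiplicative functions $A,B$ (functions $\mathbb{N}^{\star}\to\mathbb{C}$ with value $1$ at $1$ and multiplicative on coprime arguments), \[ A^{2}\,\square\,\big((-1)^{\omega}B^{2}\big)=\big(A\,\square\,(-1)^{\omega}B\big)\times\big(A\,\square\,B\big), \] where $A^2(n)=A(n)^2$, $((-1)^{\omega}B)(n)=(-1)^{\omega(n)}B(n)$, and $((-1)^{\omega}B^2)(n)=(-1)^{\omega(n)}B(n)^2$.
   Context: $\omega(n)$ is the number of distinct prime divisors of $n$; $\times$ is the pointwise product; $(F\,\square\,G)(n)=\sum_{ab=n,\ \gcd(a,b)=1}F(a)G(b)$. -}

module Defs where

open import Level using (Level)
open import Data.Nat using (ℕ; zero; suc; _≟_; _≤_) renaming (_*_ to _*ℕ_)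
open import Data.Nat.Divisibility using (_∣?_)
open import Data.Nat.Primality using (prime?)
open import Data.Nat.GCD using (gcd)
open import Data.Nat.Coprimality using (Coprime)
open import Data.List using (List; []; _∷_; length; filter; concatMap; map; foldr)
open import Relation.Nullary.Decidable using (_×-dec_)
open import Algebra.Bundles using (CommutativeRing)

range1 : ℕ → List ℕ
range1 zero = []
range1 (suc n) = range1 n Data.List.++ (suc n ∷ [])

ω : ℕ → ℕ
ω n = length (filter (λ p → prime? p ×-dec p ∣? n) (range1 n))

open import Data.Product using (_×_; _,_)

unitaryPairs : ℕ → List (ℕ × ℕ)
unitaryPairs n =
  filter (λ { (a , b) → (a *ℕ b ≟ n) ×-dec (gcd a b ≟ 1) })
         (concatMap (λ a → map (λ b → (a , b)) (range1 n)) (range1 n))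

module Arith {c ℓ : Level} (R : CommutativeRing c ℓ) where
  open CommutativeRing R

  negOnePow : ℕ → Carrier
  negOnePow zero = 1#
  negOnePow (suc k) = (- 1#) * negOnePow k

  -- arithmetic functions ℕ* → R (value at 0 is irrelevant)
  ArithFun : Set c
  ArithFun = ℕ → Carrier

  IsMultiplicative : ArithFun → Set ℓ
  IsMultiplicative F =
    (F 1 ≈ 1#) ×
    (∀ m n → 1 ≤ m → 1 ≤ n → Coprime m n → F (m *ℕ n) ≈ F m * F n)

  _□_ : ArithFun → ArithFun → ArithFun
  (F □ G) n = foldr (λ { (a , b) acc → F a * G b + acc }) 0# (unitaryPairs n)

  _⊗_ : ArithFun → ArithFun → ArithFun
  (F ⊗ G) n = F n * G n

  signω : ArithFun → ArithFun
  signω F n = negOnePow (ω n) * F n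

  sq : ArithFun → ArithFun
  sq F n = F n * F n

module Submission where

-- Both sides are multiplicative: unitary convolution and pointwise products preserve
-- multiplicativity, and so does the twist by (-1)^ω because ω is additive on coprime
-- arguments. Multiplicative functions agreeing on prime powers agree everywhere, and the only
-- unitary factorisations of N = p^k are N·1 and 1·N; so at N, with a = A(N) and b = B(N),
-- the two sides are a² - b² and (a - b)(a + b).

open import Level using (Level)
open import Algebra.Bundles using (CommutativeRing)
open import Data.Empty using (⊥-elim)
open import Data.Fin using (toℕ)
open import Data.Fin.Properties using (toℕ<n; toℕ-inject₁; toℕ-fromℕ)
open import Data.List using (List; []; _∷_; _++_; map; filter; concatMap; foldr; length)
import Data.List.Properties as List
open import Data.List.Relation.Unary.All using (_∷_)
open import Data.Nat as ℕ using (ℕ; zero; suc; z≤n; s≤s; _≤_; _<_; _^_)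
import Data.Nat.Properties as ℕ
open import Data.Nat.Coprimality as Coprime using (Coprime; coprime-divisor; coprime⇒gcd≡1; gcd≡1⇒coprime)
open import Data.Nat.Divisibility
open import Data.Nat.GCD
open import Data.Nat.Induction using (<-rec)
open import Data.Nat.ListAction using (product)
open import Data.Nat.Primality
open import Data.Nat.Primality.Factorisation using (factorise)
open import Data.Product using (_×_; _,_; proj₁; proj₂; ∃; ∃₂)
open import Data.Product.Properties using (≡-dec; ×-≡,≡←≡)
open import Data.Sum using (_⊎_; inj₁; inj₂)
open import Function using (_∘_; _⇔_; mk⇔; Equivalence)
open import Relation.Binary.PropositionalEquality as ≡ using (_≡_; _≢_)
open import Relation.Nullary using (¬_; Dec; yes; no)
open import Relation.Nullary.Decidable using (_×-dec_)
open import Relation.Unary using (Pred; Decidable)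
open import Defs

private
  variable
    ℓa ℓb ℓp ℓq ℓs : Level
    A : Set ℓa
    B : Set ℓb
    P : Set ℓp
    Q : Set ℓq
    S : Set ℓs

module _ where
  open import Data.Nat
  open import Data.Nat.Properties
  open import Relation.Binary.PropositionalEquality
  open import Algebra.Properties.CommutativeSemigroup *-commutativeSemigroup using () renaming (interchange to *-interchange)
  open import Algebra.Properties.CommutativeSemigroup +-commutativeSemigroup using () renaming (interchange to +-interchange)

  -- Coprimality and prime powers

  coprime-*ˡ : ∀ {a b n} → Coprime a n → Coprime b n → Coprime (a * b) n
  coprime-*ˡ a⊥n b⊥n (d∣ab , d∣n) =
    b⊥n (coprime-divisor (λ (e∣d , e∣a) → a⊥n (e∣a , ∣-trans e∣d d∣n)) d∣ab , d∣n)

  coprime-∣ : ∀ {m n a b} → Coprime m n → a ∣ m → b ∣ n → Coprime a b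
  coprime-∣ m⊥n a∣m b∣n (d∣a , d∣b) = m⊥n (∣-trans d∣a a∣m , ∣-trans d∣b b∣n)

  coprime-*-∣ : ∀ {a b n} → Coprime a b → a ∣ n → b ∣ n → a * b ∣ n
  coprime-*-∣ {a} {b} a⊥b (divides t refl) b∣ta =
    subst (a * b ∣_) (*-comm a t) (*-monoʳ-∣ a (coprime-divisor (Coprime.sym a⊥b) (subst (b ∣_) (*-comm t a) b∣ta)))

  gcd[ca,cb]≡c : ∀ c {a b} → Coprime a b → gcd (c * a) (c * b) ≡ c
  gcd[ca,cb]≡c c {a} {b} a⊥b = begin
    gcd (c * a) (c * b) ≡⟨ c*gcd[m,n]≡gcd[cm,cn] c a b ⟨
    c * gcd a b         ≡⟨ cong (c *_) (coprime⇒gcd≡1 a⊥b) ⟩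
    c * 1               ≡⟨ *-identityʳ c ⟩
    c                   ∎
    where open ≡-Reasoning

  ∣*⇒≡gcd*gcd : ∀ {d a b} → Coprime a b → d ∣ a * b → d ≡ gcd d a * gcd d b
  ∣*⇒≡gcd*gcd {d} {a} {b} a⊥b d∣ab = ∣-antisym d∣gcd*gcd gcd*gcd∣d
    where
    gcd*gcd∣d : gcd d a * gcd d b ∣ d
    gcd*gcd∣d = coprime-*-∣ (coprime-∣ a⊥b (gcd[m,n]∣n d a) (gcd[m,n]∣n d b)) (gcd[m,n]∣m d a) (gcd[m,n]∣m d b)
    d∣gcd*b : d ∣ gcd d a * b
    d∣gcd*b = subst (d ∣_) (trans (sym (c*gcd[m,n]≡gcd[cm,cn] b d a)) (*-comm b _))
                (gcd-greatest (n∣m*n b) (subst (d ∣_) (*-comm a b) d∣ab))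
    d∣gcd*gcd : d ∣ gcd d a * gcd d b
    d∣gcd*gcd = subst (d ∣_) (sym (c*gcd[m,n]≡gcd[cm,cn] (gcd d a) d b)) (gcd-greatest (n∣m*n (gcd d a)) d∣gcd*b)

  coprime-*ʳ : ∀ {n a b} → Coprime n a → Coprime n b → Coprime n (a * b)
  coprime-*ʳ n⊥a n⊥b = Coprime.sym (coprime-*ˡ (Coprime.sym n⊥a) (Coprime.sym n⊥b))

  coprime-^ˡ : ∀ {a n} k → Coprime a n → Coprime (a ^ k) n
  coprime-^ˡ zero    _   = Coprime.1-coprimeTo _
  coprime-^ˡ (suc k) a⊥n = coprime-*ˡ a⊥n (coprime-^ˡ k a⊥n)

  prime∤⇒coprime : ∀ {p n} → Prime p → ¬ p ∣ n → Coprime p n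
  prime∤⇒coprime pp p∤n (d∣p , d∣n) with prime⇒irreducible pp d∣p
  ... | inj₁ d≡1 = d≡1
  ... | inj₂ refl = ⊥-elim (p∤n d∣n)

  prime∣p^k⇒≡p : ∀ {p r} k → Prime p → Prime r → r ∣ p ^ k → r ≡ p
  prime∣p^k⇒≡p zero    _  pr r∣1 = ⊥-elim (nonTrivial⇒≢1 {{prime⇒nonTrivial pr}} (∣1⇒≡1 r∣1))
  prime∣p^k⇒≡p {p} (suc k) pp pr r∣p^k with euclidsLemma p (p ^ k) pr r∣p^k
  ... | inj₂ r∣p^k′ = prime∣p^k⇒≡p k pp pr r∣p^k′
  ... | inj₁ r∣p with prime⇒irreducible pp r∣p
  ...   | inj₁ r≡1 = ⊥-elim (nonTrivial⇒≢1 {{prime⇒nonTrivial pr}} r≡1)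
  ...   | inj₂ r≡p = r≡p

  ∃-prime-∣ : ∀ {n} → 1 < n → ∃ λ p → Prime p × p ∣ n
  ∃-prime-∣ {suc n} 1<n with factorise (suc n)
  ... | record { factors = [] ; isFactorisation = n≡1 } = ⊥-elim (<⇒≢ 1<n (sym n≡1))
  ... | record { factors = p ∷ ps ; isFactorisation = eq ; factorsPrime = pp ∷ _ } =
    p , pp , ∣-trans (m∣m*n (product ps)) (∣-reflexive (sym eq))

  p-adic-split : ∀ {p} → Prime p → ∀ n → 1 ≤ n → ∃₂ λ k m → n ≡ p ^ k * m × ¬ p ∣ m
  p-adic-split {p} pp = <-rec _ split
    where
    split : ∀ n → (∀ {q} → q < n → 1 ≤ q → ∃₂ λ k m → q ≡ p ^ k * m × ¬ p ∣ m) →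
            1 ≤ n → ∃₂ λ k m → n ≡ p ^ k * m × ¬ p ∣ m
    split n rec 1≤n with p ∣? n
    ... | no p∤n = 0 , n , sym (*-identityˡ n) , p∤n
    ... | yes (divides q n≡qp) with q | n≡qp
    ...   | zero  | refl = ⊥-elim (<⇒≢ 1≤n refl)
    ...   | suc q | refl with rec (m<m*n (suc q) p (nonTrivial⇒n>1 p {{prime⇒nonTrivial pp}})) (s≤s z≤n)
    ...     | k , m , q≡p^km , p∤m = suc k , m , p^k+1*m , p∤m
      where
      p^k+1*m : suc q * p ≡ p ^ suc k * m
      p^k+1*m = trans (cong (_* p) q≡p^km) (trans (*-comm (p ^ k * m) p) (sym (*-assoc p (p ^ k) m)))

  coprime-induction : ∀ {ℓ} (P : Pred ℕ ℓ) → P 1 → (∀ {p} k → Prime p → P (p ^ suc k)) →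
                      (∀ {m n} → 1 ≤ m → 1 ≤ n → Coprime m n → P m → P n → P (m * n)) →
                      ∀ n → 1 ≤ n → P n
  coprime-induction P P1 Pp^k P* = <-rec _ step
    where
    step : ∀ n → (∀ {m} → m < n → 1 ≤ m → P m) → 1 ≤ n → P n
    step n rec 1≤n with n ≟ 1
    ... | yes refl = P1
    ... | no n≢1 with ∃-prime-∣ (≤∧≢⇒< 1≤n (≢-sym n≢1))
    ...   | p , pp , p∣n with p-adic-split pp n 1≤n
    ...     | zero , m , refl , p∤m = ⊥-elim (p∤m (subst (p ∣_) (*-identityˡ m) p∣n))
    ...     | suc k , zero , n≡0 , _ = ⊥-elim (<⇒≢ 1≤n (sym (trans n≡0 (*-zeroʳ (p ^ suc k)))))
    ...     | suc k , 1 , refl , _ = subst P (sym (*-identityʳ (p ^ suc k))) (Pp^k k pp)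
    ...     | suc k , m@(suc (suc _)) , refl , p∤m =
      P* 1≤p^k (s≤s z≤n) p^k⊥m (rec p^k<n 1≤p^k) (rec m<n (s≤s z≤n))
      where
      instance _ = prime⇒nonZero pp
      1≤p^k : 1 ≤ p ^ suc k
      1≤p^k = m^n>0 p (suc k)
      p^k⊥m : Coprime (p ^ suc k) m
      p^k⊥m = coprime-^ˡ (suc k) (prime∤⇒coprime pp p∤m)
      p^k<n : p ^ suc k < p ^ suc k * m
      p^k<n = m<m*n (p ^ suc k) m {{>-nonZero 1≤p^k}} (s≤s (s≤s z≤n))
      m<n : m < p ^ suc k * m
      m<n = subst (m <_) (*-comm m (p ^ suc k))
              (m<m*n m (p ^ suc k) (<-≤-trans (nonTrivial⇒n>1 p {{prime⇒nonTrivial pp}}) (m≤m*n p (p ^ k) {{m^n≢0 p k}})))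

  -- Unitary factorisations

  infix 4 _∈1‥_
  _∈1‥_ : ℕ → ℕ → Set
  x ∈1‥ n = 1 ≤ x × x ≤ n

  *≡⇒∈1‥ : ∀ {a b n} → a * b ≡ n → 1 ≤ n → a ∈1‥ n × b ∈1‥ n
  *≡⇒∈1‥ {a} {b} refl 1≤ab = (>-nonZero⁻¹ a {{m*n≢0⇒m≢0 a}} , ∣⇒≤ (m∣m*n b))
                           , (>-nonZero⁻¹ b {{m*n≢0⇒n≢0 a}} , ∣⇒≤ (n∣m*n a))
    where instance _ = >-nonZero 1≤ab

  ∈1‥-* : ∀ {a c m q} → a ∈1‥ m → c ∈1‥ q → a * c ∈1‥ m * q
  ∈1‥-* (1≤a , a≤m) (1≤c , c≤q) = *-mono-≤ 1≤a 1≤c , *-mono-≤ a≤m c≤q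

  Unitary : ℕ → ℕ → ℕ → Set
  Unitary n a b = a * b ≡ n × gcd a b ≡ 1

  unitary? : ∀ n a b → Dec (Unitary n a b)
  unitary? n a b = (a * b ≟ n) ×-dec (gcd a b ≟ 1)

  unitary-comm : ∀ {n a b} → Unitary n a b → Unitary n b a
  unitary-comm {a = a} {b} (ab≡n , gcd≡1) = trans (*-comm b a) ab≡n , trans (gcd-comm b a) gcd≡1

  unitary-* : ∀ {m q a b c d} → Coprime m q → Unitary m a b → Unitary q c d →
              Unitary (m * q) (a * c) (b * d)
  unitary-* {a = a} {b} {c} {d} m⊥q (refl , gcd[a,b]≡1) (refl , gcd[c,d]≡1) =
    *-interchange a c b d , coprime⇒gcd≡1 (coprime-*ˡ (coprime-*ʳ a⊥b a⊥d) (coprime-*ʳ c⊥b c⊥d))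
    where
    a⊥b : Coprime a b
    a⊥b = gcd≡1⇒coprime gcd[a,b]≡1
    c⊥d : Coprime c d
    c⊥d = gcd≡1⇒coprime gcd[c,d]≡1
    a⊥d : Coprime a d
    a⊥d = coprime-∣ m⊥q (m∣m*n b) (n∣m*n c)
    c⊥b : Coprime c b
    c⊥b = coprime-∣ (Coprime.sym m⊥q) (m∣m*n d) (n∣m*n a)

  unitary-gcd : ∀ {m q e f} → Coprime m q → Unitary (m * q) e f →
                Unitary m (gcd e m) (gcd f m) × Unitary q (gcd e q) (gcd f q) ×
                gcd e m * gcd e q ≡ e × gcd f m * gcd f q ≡ f
  unitary-gcd {m} {q} {e} {f} m⊥q (ef≡mq , gcd[e,f]≡1) =
    unitary-of (subst (m ∣_) (sym ef≡mq) (m∣m*n q)) ,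
    unitary-of (subst (q ∣_) (sym ef≡mq) (n∣m*n m)) ,
    sym (∣*⇒≡gcd*gcd m⊥q (subst (e ∣_) ef≡mq (m∣m*n f))) ,
    sym (∣*⇒≡gcd*gcd m⊥q (subst (f ∣_) ef≡mq (n∣m*n e)))
    where
    e⊥f : Coprime e f
    e⊥f = gcd≡1⇒coprime gcd[e,f]≡1
    unitary-of : ∀ {n} → n ∣ e * f → Unitary n (gcd e n) (gcd f n)
    unitary-of {n} n∣ef = trans (cong₂ _*_ (gcd-comm e n) (gcd-comm f n)) (sym (∣*⇒≡gcd*gcd e⊥f n∣ef))
                        , coprime⇒gcd≡1 (coprime-∣ e⊥f (gcd[m,n]∣m e n) (gcd[m,n]∣m f n))

  unitary-*-gcd : ∀ {m q a b c d} → Coprime m q → Unitary m a b → Unitary q c d →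
                  gcd (a * c) m ≡ a × gcd (b * d) m ≡ b × gcd (a * c) q ≡ c × gcd (b * d) q ≡ d
  unitary-*-gcd {a = a} {b} {c} {d} m⊥q (refl , _) (refl , _) =
    gcd[ca,cb]≡c a c⊥b ,
    trans (cong (gcd (b * d)) (*-comm a b)) (gcd[ca,cb]≡c b d⊥a) ,
    trans (cong (λ x → gcd x (c * d)) (*-comm a c)) (gcd[ca,cb]≡c c a⊥d) ,
    trans (cong₂ gcd (*-comm b d) (*-comm c d)) (gcd[ca,cb]≡c d b⊥c)
    where
    a⊥d : Coprime a d
    a⊥d = coprime-∣ m⊥q (m∣m*n b) (n∣m*n c)
    b⊥c : Coprime b c
    b⊥c = coprime-∣ m⊥q (n∣m*n a) (m∣m*n d)
    c⊥b = Coprime.sym b⊥c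
    d⊥a = Coprime.sym a⊥d

  unitary-p^k-∣ : ∀ {p k a b} → Prime p → Unitary (p ^ suc k) a b → p ∣ a → b ≡ 1
  unitary-p^k-∣ {p} {k} {a} {b} pp (ab≡p^k , gcd[a,b]≡1) p∣a = b⊥p^k (∣-refl , b∣p^k)
    where
    p∤b : ¬ p ∣ b
    p∤b p∣b = nonTrivial⇒≢1 {{prime⇒nonTrivial pp}} (gcd≡1⇒coprime gcd[a,b]≡1 (p∣a , p∣b))
    b⊥p^k : Coprime b (p ^ suc k)
    b⊥p^k = Coprime.sym (coprime-^ˡ (suc k) (prime∤⇒coprime pp p∤b))
    b∣p^k : b ∣ p ^ suc k
    b∣p^k = subst (b ∣_) ab≡p^k (n∣m*n a)

  unitary-p^k : ∀ {p k a b} → Prime p → Unitary (p ^ suc k) a b →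
                (a ≡ p ^ suc k × b ≡ 1) ⊎ (a ≡ 1 × b ≡ p ^ suc k)
  unitary-p^k {p} {k} {a} {b} pp u@(ab≡p^k , _)
    with euclidsLemma a b pp (subst (p ∣_) (sym ab≡p^k) (m∣m*n (p ^ k)))
  ... | inj₁ p∣a = inj₁ (trans (sym (*-identityʳ a)) (subst (λ x → a * x ≡ _) b≡1 ab≡p^k) , b≡1)
    where b≡1 = unitary-p^k-∣ {p} {k} pp u p∣a
  ... | inj₂ p∣b = inj₂ (a≡1 , trans (sym (*-identityʳ b)) (subst (λ x → b * x ≡ _) a≡1 (proj₁ u′)))
    where
    u′ = unitary-comm {a = a} {b} u
    a≡1 = unitary-p^k-∣ {p} {k} pp u′ p∣b

  -- Counting prime divisors

  indicator : Dec P → ℕ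
  indicator (yes _) = 1
  indicator (no _)  = 0

  indicator-yes : P → (P? : Dec P) → indicator P? ≡ 1
  indicator-yes _ (yes _) = refl
  indicator-yes p (no ¬p) = ⊥-elim (¬p p)

  indicator-no : ¬ P → (P? : Dec P) → indicator P? ≡ 0
  indicator-no ¬p (yes p) = ⊥-elim (¬p p)
  indicator-no _  (no _)  = refl

  indicator-⇔ : P ⇔ Q → (P? : Dec P) (Q? : Dec Q) → indicator P? ≡ indicator Q?
  indicator-⇔ _   (yes _) (yes _) = refl
  indicator-⇔ _   (no _)  (no _)  = refl
  indicator-⇔ P⇔Q (yes p) (no ¬q) = ⊥-elim (¬q (Equivalence.to P⇔Q p))
  indicator-⇔ P⇔Q (no ¬p) (yes q) = ⊥-elim (¬p (Equivalence.from P⇔Q q))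

  indicator-⊎ : P ⇔ (Q ⊎ S) → ¬ (Q × S) →
                (P? : Dec P) (Q? : Dec Q) (S? : Dec S) → indicator P? ≡ indicator Q? + indicator S?
  indicator-⊎ P⇔Q⊎S _ (no ¬p) (yes q) _       = ⊥-elim (¬p (Equivalence.from P⇔Q⊎S (inj₁ q)))
  indicator-⊎ P⇔Q⊎S _ (no ¬p) (no _)  (yes s) = ⊥-elim (¬p (Equivalence.from P⇔Q⊎S (inj₂ s)))
  indicator-⊎ _      _ (no _)  (no _)  (no _)  = refl
  indicator-⊎ _      _ (yes _) (yes _) (no _)  = refl
  indicator-⊎ _      _ (yes _) (no _)  (yes _) = refl
  indicator-⊎ _  ¬Q×S (yes _) (yes q) (yes s) = ⊥-elim (¬Q×S (q , s))
  indicator-⊎ P⇔Q⊎S _ (yes p) (no ¬q) (no ¬s) with Equivalence.to P⇔Q⊎S p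
  ... | inj₁ q = ⊥-elim (¬q q)
  ... | inj₂ s = ⊥-elim (¬s s)

  count : ∀ {p} {P : Pred ℕ p} → Decidable P → ℕ → ℕ
  count P? N = length (filter P? (range1 N))

  module _ {p} {P : Pred ℕ p} (P? : Decidable P) where

    count-suc : ∀ N → count P? (suc N) ≡ count P? N + indicator (P? (suc N))
    count-suc N = begin
      length (filter P? (range1 N ++ suc N ∷ []))
        ≡⟨ cong length (List.filter-++ P? (range1 N) _) ⟩
      length (filter P? (range1 N) ++ filter P? (suc N ∷ []))
        ≡⟨ List.length-++ (filter P? (range1 N)) ⟩
      count P? N + length (filter P? (suc N ∷ []))
        ≡⟨ cong (count P? N +_) singleton ⟩
      count P? N + indicator (P? (suc N))
        ∎
      where
      open ≡-Reasoning
      singleton : length (filter P? (suc N ∷ [])) ≡ indicator (P? (suc N))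
      singleton with P? (suc N)
      ... | yes _ = refl
      ... | no _  = refl

    count-beyond : ∀ {N M} → N ≤ M → (∀ r → N < r → r ≤ M → ¬ P r) → count P? M ≡ count P? N
    count-beyond {N} {zero} z≤n _ = refl
    count-beyond {N} {suc M} N≤M+1 ¬P with m≤n⇒m<n∨m≡n N≤M+1
    ... | inj₂ refl = refl
    ... | inj₁ (s≤s N≤M) = begin
      count P? (suc M)
        ≡⟨ count-suc M ⟩
      count P? M + indicator (P? (suc M))
        ≡⟨ cong₂ _+_ (count-beyond N≤M (λ r N<r r≤M → ¬P r N<r (m≤n⇒m≤1+n r≤M)))
                     (indicator-no (¬P (suc M) (s≤s N≤M) ≤-refl) (P? (suc M))) ⟩
      count P? N + 0
        ≡⟨ +-identityʳ _ ⟩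
      count P? N
        ∎
      where open ≡-Reasoning

  count-cong : ∀ {p q} {P : Pred ℕ p} {Q : Pred ℕ q} (P? : Decidable P) (Q? : Decidable Q) →
               (∀ r → P r ⇔ Q r) → ∀ N → count P? N ≡ count Q? N
  count-cong P? Q? P⇔Q zero = refl
  count-cong P? Q? P⇔Q (suc N) = begin
    count P? (suc N)
      ≡⟨ count-suc P? N ⟩
    count P? N + indicator (P? (suc N))
      ≡⟨ cong₂ _+_ (count-cong P? Q? P⇔Q N) (indicator-⇔ (P⇔Q (suc N)) _ _) ⟩
    count Q? N + indicator (Q? (suc N))
      ≡⟨ count-suc Q? N ⟨
    count Q? (suc N)
      ∎
    where open ≡-Reasoning

  count-⊎ : ∀ {p q s} {P : Pred ℕ p} {Q : Pred ℕ q} {S : Pred ℕ s}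
            (P? : Decidable P) (Q? : Decidable Q) (S? : Decidable S) →
            (∀ r → P r ⇔ (Q r ⊎ S r)) → (∀ r → ¬ (Q r × S r)) →
            ∀ N → count P? N ≡ count Q? N + count S? N
  count-⊎ P? Q? S? P⇔Q⊎S disjoint zero = refl
  count-⊎ P? Q? S? P⇔Q⊎S disjoint (suc N) = begin
    count P? (suc N)
      ≡⟨ count-suc P? N ⟩
    count P? N + indicator (P? (suc N))
      ≡⟨ cong₂ _+_ (count-⊎ P? Q? S? P⇔Q⊎S disjoint N)
                   (indicator-⊎ (P⇔Q⊎S (suc N)) (disjoint (suc N)) (P? (suc N)) (Q? (suc N)) (S? (suc N))) ⟩
    (count Q? N + count S? N) + (indicator (Q? (suc N)) + indicator (S? (suc N)))
      ≡⟨ +-interchange (count Q? N) _ _ _ ⟩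
    (count Q? N + indicator (Q? (suc N))) + (count S? N + indicator (S? (suc N)))
      ≡⟨ cong₂ _+_ (count-suc Q? N) (count-suc S? N) ⟨
    count Q? (suc N) + count S? (suc N)
      ∎
    where open ≡-Reasoning

  count-≡ : ∀ {p N} → 1 ≤ p → p ≤ N → count (_≟ p) N ≡ 1
  count-≡ {suc p} {N} _ p+1≤N = begin
    count (_≟ suc p) N
      ≡⟨ count-beyond (_≟ suc p) p+1≤N (λ r p+1<r _ r≡p+1 → <⇒≢ p+1<r (sym r≡p+1)) ⟩
    count (_≟ suc p) (suc p)
      ≡⟨ count-suc (_≟ suc p) p ⟩
    count (_≟ suc p) p + indicator (suc p ≟ suc p)
      ≡⟨ cong₂ _+_ (count-beyond (_≟ suc p) z≤n (λ r _ r≤p r≡p+1 → <⇒≢ (s≤s r≤p) r≡p+1))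
                   (indicator-yes refl (suc p ≟ suc p)) ⟩
    0 + 1
      ∎
    where open ≡-Reasoning

  PrimeDivisor : ℕ → Pred ℕ _
  PrimeDivisor n r = Prime r × r ∣ n

  primeDivisor? : ∀ n → Decidable (PrimeDivisor n)
  primeDivisor? n r = prime? r ×-dec r ∣? n

  count-primeDivisor-beyond : ∀ {n N} → 1 ≤ n → n ≤ N → count (primeDivisor? n) N ≡ ω n
  count-primeDivisor-beyond {n} 1≤n n≤N =
    count-beyond (primeDivisor? n) n≤N (λ r n<r _ (_ , r∣n) → >⇒∤ {{>-nonZero 1≤n}} n<r r∣n)

  ω-* : ∀ {m n} → 1 ≤ m → 1 ≤ n → Coprime m n → ω (m * n) ≡ ω m + ω n
  ω-* {m} {n} 1≤m 1≤n m⊥n = begin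
    count (primeDivisor? (m * n)) (m * n)
      ≡⟨ count-⊎ _ (primeDivisor? m) (primeDivisor? n) split disjoint (m * n) ⟩
    count (primeDivisor? m) (m * n) + count (primeDivisor? n) (m * n)
      ≡⟨ cong₂ _+_ (count-primeDivisor-beyond 1≤m (m≤m*n m n {{>-nonZero 1≤n}}))
                   (count-primeDivisor-beyond 1≤n (m≤n*m n m {{>-nonZero 1≤m}})) ⟩
    ω m + ω n
      ∎
    where
    open ≡-Reasoning
    split : ∀ r → PrimeDivisor (m * n) r ⇔ (PrimeDivisor m r ⊎ PrimeDivisor n r)
    split r = mk⇔ (λ (pr , r∣mn) → Data.Sum.map (pr ,_) (pr ,_) (euclidsLemma m n pr r∣mn))
                  (λ { (inj₁ (pr , r∣m)) → pr , ∣m⇒∣m*n n r∣m ; (inj₂ (pr , r∣n)) → pr , ∣n⇒∣m*n m r∣n })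
    disjoint : ∀ r → ¬ (PrimeDivisor m r × PrimeDivisor n r)
    disjoint r ((pr , r∣m) , (_ , r∣n)) = nonTrivial⇒≢1 {{prime⇒nonTrivial pr}} (m⊥n (r∣m , r∣n))

  ω-p^k : ∀ {p} k → Prime p → ω (p ^ suc k) ≡ 1
  ω-p^k {p} k pp = begin
    count (primeDivisor? (p ^ suc k)) (p ^ suc k)
      ≡⟨ count-cong _ (_≟ p) prime-divisors (p ^ suc k) ⟩
    count (_≟ p) (p ^ suc k)
      ≡⟨ count-≡ (>-nonZero⁻¹ p) (m≤m*n p (p ^ k) {{m^n≢0 p k}}) ⟩
    1
      ∎
    where
    open ≡-Reasoning
    instance _ = prime⇒nonZero pp
    prime-divisors : ∀ r → PrimeDivisor (p ^ suc k) r ⇔ r ≡ p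
    prime-divisors r = mk⇔ (λ (pr , r∣p^k) → prime∣p^k⇒≡p (suc k) pp pr r∣p^k)
                           (λ { refl → pp , m∣m*n (p ^ k) })

module _ {c ℓ : Level} (R : CommutativeRing c ℓ) where
  open CommutativeRing R
  open Arith R
  open import Algebra.Properties.Semiring.Sum semiring
    using (sum; ∑-comm; ∑-distrib-+; *-distribˡ-sum; *-distribʳ-sum; sum-cong-≋; sum-cong-≗; sum-replicate-zero; sum-init-last)
  open import Relation.Binary.Reasoning.Setoid setoid
  open import Algebra.Properties.CommutativeSemigroup *-commutativeSemigroup using (interchange)
  open import Algebra.Properties.Ring ring using (-1*x≈-x; -‿distribˡ-*)

  -- Finite sums

  -- Sums over x = 1, …, n, kept opaque so that n and the summand are recovered by unification.
  opaque
    ∑₁ : ℕ → (ℕ → Carrier) → Carrier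
    ∑₁ n f = sum {n} λ i → f (suc (toℕ i))

  syntax ∑₁ n (λ x → e) = ∑[ x ∈1‥ n ] e

  opaque
    unfolding ∑₁

    ∑₁-cong : ∀ {n f g} → (∀ x → x ∈1‥ n → f x ≈ g x) → ∑₁ n f ≈ ∑₁ n g
    ∑₁-cong f≈g = sum-cong-≋ λ i → f≈g _ (s≤s z≤n , toℕ<n i)

    ∑₁-zero : ∀ {n f} → (∀ x → x ∈1‥ n → f x ≈ 0#) → ∑₁ n f ≈ 0#
    ∑₁-zero {n} f≈0 = trans (∑₁-cong f≈0) (sum-replicate-zero n)

    ∑₁-suc : ∀ {n} f → ∑₁ (suc n) f ≈ ∑₁ n f + f (suc n)
    ∑₁-suc {n} f = trans (sum-init-last {n} (λ i → f (suc (toℕ i))))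
      (+-cong (reflexive (sum-cong-≗ {n} λ i → ≡.cong (λ k → f (suc k)) (toℕ-inject₁ i)))
              (reflexive (≡.cong (λ k → f (suc k)) (toℕ-fromℕ n))))

    ∑₁-distrib-+ : ∀ {n} f g → ∑[ x ∈1‥ n ] (f x + g x) ≈ ∑₁ n f + ∑₁ n g
    ∑₁-distrib-+ {n} f g = ∑-distrib-+ {n} (λ i → f (suc (toℕ i))) (λ i → g (suc (toℕ i)))

    ∑₁-comm : ∀ {m n} (h : ℕ → ℕ → Carrier) →
              ∑[ x ∈1‥ m ] ∑[ y ∈1‥ n ] h x y ≈ ∑[ y ∈1‥ n ] ∑[ x ∈1‥ m ] h x y
    ∑₁-comm {m} {n} h = ∑-comm {m} {n} λ i j → h (suc (toℕ i)) (suc (toℕ j))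

    *-distribˡ-∑₁ : ∀ {n} a f → a * ∑₁ n f ≈ ∑[ x ∈1‥ n ] (a * f x)
    *-distribˡ-∑₁ {n} a f = *-distribˡ-sum {n} a λ i → f (suc (toℕ i))

    *-distribʳ-∑₁ : ∀ {n} a f → ∑₁ n f * a ≈ ∑[ x ∈1‥ n ] (f x * a)
    *-distribʳ-∑₁ {n} a f = *-distribʳ-sum {n} a λ i → f (suc (toℕ i))

  ∑₁-single : ∀ {n f} x₀ → x₀ ∈1‥ n → (∀ x → x ∈1‥ n → x ≢ x₀ → f x ≈ 0#) → ∑₁ n f ≈ f x₀
  ∑₁-single {zero} (suc _) (_ , ()) _
  ∑₁-single {suc n} {f} x₀ (1≤x₀ , x₀≤n+1) f≈0 with ℕ.m≤n⇒m<n∨m≡n x₀≤n+1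
  ... | inj₁ (s≤s x₀≤n) = begin
    ∑₁ (suc n) f
      ≈⟨ ∑₁-suc f ⟩
    ∑₁ n f + f (suc n)
      ≈⟨ +-cong (∑₁-single x₀ (1≤x₀ , x₀≤n) λ x (1≤x , x≤n) → f≈0 x (1≤x , ℕ.m≤n⇒m≤1+n x≤n))
                (f≈0 (suc n) (s≤s z≤n , ℕ.≤-refl) (ℕ.<⇒≢ (s≤s x₀≤n) ∘ ≡.sym)) ⟩
    f x₀ + 0#
      ≈⟨ +-identityʳ _ ⟩
    f x₀
      ∎
  ... | inj₂ ≡.refl = begin
    ∑₁ (suc n) f
      ≈⟨ ∑₁-suc f ⟩
    ∑₁ n f + f (suc n)
      ≈⟨ +-congʳ (∑₁-zero λ x (1≤x , x≤n) → f≈0 x (1≤x , ℕ.m≤n⇒m≤1+n x≤n) (ℕ.<⇒≢ (s≤s x≤n))) ⟩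
    0# + f (suc n)
      ≈⟨ +-identityˡ _ ⟩
    f (suc n)
      ∎

  ∑² : ℕ → (ℕ → ℕ → Carrier) → Carrier
  ∑² n h = ∑[ a ∈1‥ n ] ∑[ b ∈1‥ n ] h a b

  ∑²-cong : ∀ {n h g} → (∀ a b → a ∈1‥ n → b ∈1‥ n → h a b ≈ g a b) → ∑² n h ≈ ∑² n g
  ∑²-cong h≈g = ∑₁-cong λ a a∈ → ∑₁-cong λ b b∈ → h≈g a b a∈ b∈

  ∑²-zero : ∀ {n h} → (∀ a b → a ∈1‥ n → b ∈1‥ n → h a b ≈ 0#) → ∑² n h ≈ 0#
  ∑²-zero h≈0 = ∑₁-zero λ a a∈ → ∑₁-zero λ b b∈ → h≈0 a b a∈ b∈

  ∑²-single : ∀ {n h} a₀ b₀ → a₀ ∈1‥ n → b₀ ∈1‥ n →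
              (∀ a b → a ∈1‥ n → b ∈1‥ n → ¬ (a ≡ a₀ × b ≡ b₀) → h a b ≈ 0#) → ∑² n h ≈ h a₀ b₀
  ∑²-single a₀ b₀ a₀∈ b₀∈ h≈0 =
    trans (∑₁-single a₀ a₀∈ λ a a∈ a≢a₀ → ∑₁-zero λ b b∈ → h≈0 a b a∈ b∈ (a≢a₀ ∘ proj₁))
          (∑₁-single b₀ b₀∈ λ b b∈ b≢b₀ → h≈0 a₀ b a₀∈ b∈ (b≢b₀ ∘ proj₂))

  ∑²-distrib-+ : ∀ {n} h g → ∑² n (λ a b → h a b + g a b) ≈ ∑² n h + ∑² n g
  ∑²-distrib-+ h g = trans (∑₁-cong λ a _ → ∑₁-distrib-+ (h a) (g a)) (∑₁-distrib-+ _ _)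

  ∑²-comm : ∀ {m n} (h : ℕ → ℕ → ℕ → ℕ → Carrier) →
            ∑² m (λ a b → ∑² n (λ c d → h a b c d)) ≈ ∑² n (λ c d → ∑² m (λ a b → h a b c d))
  ∑²-comm h = begin
    ∑[ a ∈1‥ _ ] ∑[ b ∈1‥ _ ] ∑[ c ∈1‥ _ ] ∑[ d ∈1‥ _ ] h a b c d
      ≈⟨ ∑₁-cong (λ a _ → ∑₁-comm λ b c → ∑₁ _ (h a b c)) ⟩
    ∑[ a ∈1‥ _ ] ∑[ c ∈1‥ _ ] ∑[ b ∈1‥ _ ] ∑[ d ∈1‥ _ ] h a b c d
      ≈⟨ ∑₁-comm (λ a c → ∑[ b ∈1‥ _ ] ∑[ d ∈1‥ _ ] h a b c d) ⟩
    ∑[ c ∈1‥ _ ] ∑[ a ∈1‥ _ ] ∑[ b ∈1‥ _ ] ∑[ d ∈1‥ _ ] h a b c d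
      ≈⟨ ∑₁-cong (λ c _ → ∑₁-cong λ a _ → ∑₁-comm λ b d → h a b c d) ⟩
    ∑[ c ∈1‥ _ ] ∑[ a ∈1‥ _ ] ∑[ d ∈1‥ _ ] ∑[ b ∈1‥ _ ] h a b c d
      ≈⟨ ∑₁-cong (λ c _ → ∑₁-comm λ a d → ∑[ b ∈1‥ _ ] h a b c d) ⟩
    ∑[ c ∈1‥ _ ] ∑[ d ∈1‥ _ ] ∑[ a ∈1‥ _ ] ∑[ b ∈1‥ _ ] h a b c d
      ∎

  ∑²-* : ∀ {m n} h g → ∑² m h * ∑² n g ≈ ∑² m (λ a b → ∑² n (λ c d → h a b * g c d))
  ∑²-* {m} {n} h g = begin
    ∑² m h * ∑² n g
      ≈⟨ *-distribʳ-∑₁ _ _ ⟩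
    ∑[ a ∈1‥ m ] (∑[ b ∈1‥ m ] h a b * ∑² n g)
      ≈⟨ ∑₁-cong (λ a _ → *-distribʳ-∑₁ _ _) ⟩
    ∑[ a ∈1‥ m ] ∑[ b ∈1‥ m ] (h a b * ∑² n g)
      ≈⟨ ∑²-cong (λ a b _ _ → *-distribˡ-∑₁ _ _) ⟩
    ∑² m (λ a b → ∑[ c ∈1‥ n ] (h a b * ∑[ d ∈1‥ n ] g c d))
      ≈⟨ ∑²-cong (λ a b _ _ → ∑₁-cong λ c _ → *-distribˡ-∑₁ _ _) ⟩
    ∑² m (λ a b → ∑² n (λ c d → h a b * g c d))
      ∎

  -- Unitary convolution as a double sum

  infixr 8 ⟦_⟧*_
  ⟦_⟧*_ : Dec P → Carrier → Carrier
  ⟦ yes _ ⟧* x = x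
  ⟦ no _  ⟧* x = 0#

  ⟦⟧*-yes : (P? : Dec P) {x : Carrier} → P → ⟦ P? ⟧* x ≈ x
  ⟦⟧*-yes (yes _) _ = refl
  ⟦⟧*-yes (no ¬p) p = ⊥-elim (¬p p)

  ⟦⟧*-no : (P? : Dec P) {x : Carrier} → ¬ P → ⟦ P? ⟧* x ≈ 0#
  ⟦⟧*-no (yes p) ¬p = ⊥-elim (¬p p)
  ⟦⟧*-no (no _)  _  = refl

  ⟦⟧*-* : (P? : Dec P) (Q? : Dec Q) {x y : Carrier} → ⟦ P? ⟧* x * ⟦ Q? ⟧* y ≈ ⟦ P? ×-dec Q? ⟧* (x * y)
  ⟦⟧*-* (yes _) (yes _) = refl
  ⟦⟧*-* (yes _) (no _)  = zeroʳ _
  ⟦⟧*-* (no _)  _       = zeroˡ _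

  ⟦⟧*-×-yes : (P? : Dec P) (Q? : Dec Q) {x : Carrier} → P → ⟦ P? ×-dec Q? ⟧* x ≈ ⟦ Q? ⟧* x
  ⟦⟧*-×-yes (yes _) (yes _) _ = refl
  ⟦⟧*-×-yes (yes _) (no _)  _ = refl
  ⟦⟧*-×-yes (no ¬p) _       p = ⊥-elim (¬p p)

  ∑ˡ : List A → (A → Carrier) → Carrier
  ∑ˡ xs f = foldr (λ x s → f x + s) 0# xs

  ∑ˡ-cong : ∀ (xs : List A) {f g} → (∀ x → f x ≈ g x) → ∑ˡ xs f ≈ ∑ˡ xs g
  ∑ˡ-cong []       f≈g = refl
  ∑ˡ-cong (x ∷ xs) f≈g = +-cong (f≈g x) (∑ˡ-cong xs f≈g)

  ∑ˡ-++ : ∀ (xs ys : List A) f → ∑ˡ (xs ++ ys) f ≈ ∑ˡ xs f + ∑ˡ ys f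
  ∑ˡ-++ []       ys f = sym (+-identityˡ _)
  ∑ˡ-++ (x ∷ xs) ys f = trans (+-congˡ (∑ˡ-++ xs ys f)) (sym (+-assoc _ _ _))

  ∑ˡ-filter : ∀ {P : Pred A ℓp} (P? : Decidable P) xs f → ∑ˡ (filter P? xs) f ≈ ∑ˡ xs (λ x → ⟦ P? x ⟧* f x)
  ∑ˡ-filter P? []       f = refl
  ∑ˡ-filter P? (x ∷ xs) f with P? x
  ... | yes _ = +-congˡ (∑ˡ-filter P? xs f)
  ... | no _  = trans (∑ˡ-filter P? xs f) (sym (+-identityˡ _))

  ∑ˡ-concatMap : ∀ (g : A → List B) xs f → ∑ˡ (concatMap g xs) f ≈ ∑ˡ xs (λ x → ∑ˡ (g x) f)
  ∑ˡ-concatMap g []       f = refl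
  ∑ˡ-concatMap g (x ∷ xs) f = trans (∑ˡ-++ (g x) _ f) (+-congˡ (∑ˡ-concatMap g xs f))

  ∑ˡ-map : ∀ (g : A → B) xs f → ∑ˡ (map g xs) f ≡ ∑ˡ xs (f ∘ g)
  ∑ˡ-map g xs f = List.foldr-map _ g 0# xs

  ∑ˡ-range1 : ∀ n f → ∑ˡ (range1 n) f ≈ ∑₁ n f
  ∑ˡ-range1 zero    f = sym (∑₁-zero λ _ (1≤x , x≤0) → ⊥-elim (ℕ.<⇒≱ 1≤x x≤0))
  ∑ˡ-range1 (suc n) f = begin
    ∑ˡ (range1 n ++ suc n ∷ []) f      ≈⟨ ∑ˡ-++ (range1 n) _ f ⟩
    ∑ˡ (range1 n) f + (f (suc n) + 0#) ≈⟨ +-cong (∑ˡ-range1 n f) (+-identityʳ _) ⟩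
    ∑₁ n f + f (suc n)                 ≈⟨ ∑₁-suc f ⟨
    ∑₁ (suc n) f                       ∎

  □≈∑² : ∀ F G n → (F □ G) n ≈ ∑² n (λ a b → ⟦ unitary? n a b ⟧* (F a * G b))
  □≈∑² F G n = begin
    (F □ G) n
      ≡⟨⟩
    ∑ˡ (unitaryPairs n) w
      ≈⟨ ∑ˡ-filter _ (concatMap pairsWith (range1 n)) w ⟩
    ∑ˡ (concatMap pairsWith (range1 n)) (λ (a , b) → T a b)
      ≈⟨ ∑ˡ-concatMap pairsWith (range1 n) _ ⟩
    ∑ˡ (range1 n) (λ a → ∑ˡ (pairsWith a) (λ (a , b) → T a b))
      ≈⟨ ∑ˡ-cong (range1 n) (λ a → reflexive (∑ˡ-map (a ,_) (range1 n) _)) ⟩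
    ∑ˡ (range1 n) (λ a → ∑ˡ (range1 n) (T a))
      ≈⟨ ∑ˡ-range1 n _ ⟩
    ∑[ a ∈1‥ n ] ∑ˡ (range1 n) (T a)
      ≈⟨ ∑₁-cong (λ a _ → ∑ˡ-range1 n (T a)) ⟩
    ∑² n T
      ∎
    where
    pairsWith : ℕ → List (ℕ × ℕ)
    pairsWith a = map (a ,_) (range1 n)
    w : ℕ × ℕ → Carrier
    w (a , b) = F a * G b
    T : ℕ → ℕ → Carrier
    T a b = ⟦ unitary? n a b ⟧* (F a * G b)

  _≟²_ : (x y : ℕ × ℕ) → Dec (x ≡ y)
  _≟²_ = ≡-dec ℕ._≟_ ℕ._≟_

  ∑²-δ : ∀ {n} a₀ b₀ {x} → a₀ ∈1‥ n → b₀ ∈1‥ n → ∑² n (λ a b → ⟦ (a , b) ≟² (a₀ , b₀) ⟧* x) ≈ x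
  ∑²-δ a₀ b₀ a₀∈ b₀∈ =
    trans (∑²-single a₀ b₀ a₀∈ b₀∈ λ a b _ _ ne → ⟦⟧*-no ((a , b) ≟² (a₀ , b₀)) (ne ∘ ×-≡,≡←≡))
          (⟦⟧*-yes ((a₀ , b₀) ≟² (a₀ , b₀)) ≡.refl)

  □-one : ∀ F G → (F □ G) 1 ≈ F 1 * G 1
  □-one F G = +-identityʳ _

  □-p^k : ∀ F G {p} k → Prime p → (F □ G) (p ^ suc k) ≈ F (p ^ suc k) * G 1 + F 1 * G (p ^ suc k)
  □-p^k F G {p} k pp = begin
    (F □ G) N
      ≈⟨ □≈∑² F G N ⟩
    ∑² N (λ a b → ⟦ unitary? N a b ⟧* (F a * G b))
      ≈⟨ ∑²-cong (λ a b _ _ → two-points a b) ⟩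
    ∑² N (λ a b → ⟦ (a , b) ≟² (N , 1) ⟧* (F N * G 1) + ⟦ (a , b) ≟² (1 , N) ⟧* (F 1 * G N))
      ≈⟨ ∑²-distrib-+ _ _ ⟩
    ∑² N (λ a b → ⟦ (a , b) ≟² (N , 1) ⟧* (F N * G 1)) + ∑² N (λ a b → ⟦ (a , b) ≟² (1 , N) ⟧* (F 1 * G N))
      ≈⟨ +-cong (∑²-δ N 1 N∈ 1∈) (∑²-δ 1 N 1∈ N∈) ⟩
    F N * G 1 + F 1 * G N
      ∎
    where
    N = p ^ suc k
    1<N : 1 < N
    1<N = ℕ.<-≤-trans (ℕ.nonTrivial⇒n>1 p {{prime⇒nonTrivial pp}})
                      (ℕ.m≤m*n p (p ^ k) {{ℕ.m^n≢0 p k {{prime⇒nonZero pp}}}})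
    N∈ : N ∈1‥ N
    N∈ = ℕ.<⇒≤ 1<N , ℕ.≤-refl
    1∈ : 1 ∈1‥ N
    1∈ = ℕ.≤-refl , ℕ.<⇒≤ 1<N
    N≢1 : N ≢ 1
    N≢1 = ℕ.<⇒≢ 1<N ∘ ≡.sym
    two-points : ∀ a b → ⟦ unitary? N a b ⟧* (F a * G b) ≈
                         ⟦ (a , b) ≟² (N , 1) ⟧* (F N * G 1) + ⟦ (a , b) ≟² (1 , N) ⟧* (F 1 * G N)
    two-points a b with unitary? N a b
    ... | no ¬u = sym (trans (+-cong (⟦⟧*-no ((a , b) ≟² (N , 1)) λ { ≡.refl → ¬u (ℕ.*-identityʳ N , gcd-zeroʳ N) })
                                     (⟦⟧*-no ((a , b) ≟² (1 , N)) λ { ≡.refl → ¬u (ℕ.*-identityˡ N , gcd-zeroˡ N) }))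
                             (+-identityʳ 0#))
    ... | yes u with unitary-p^k {p} {k} {a} {b} pp u
    ...   | inj₁ (≡.refl , ≡.refl) =
      sym (trans (+-cong (⟦⟧*-yes ((N , 1) ≟² (N , 1)) ≡.refl)
                         (⟦⟧*-no ((N , 1) ≟² (1 , N)) (N≢1 ∘ ≡.cong proj₁)))
                 (+-identityʳ _))
    ...   | inj₂ (≡.refl , ≡.refl) =
      sym (trans (+-cong (⟦⟧*-no ((1 , N) ≟² (N , 1)) (N≢1 ∘ ≡.sym ∘ ≡.cong proj₁))
                         (⟦⟧*-yes ((1 , N) ≟² (1 , N)) ≡.refl))
                 (+-identityˡ _))

  -- Multiplicative functions

  Multiplicative : ArithFun → Set ℓ
  Multiplicative F = ∀ m n → 1 ≤ m → 1 ≤ n → Coprime m n → F (m ℕ.* n) ≈ F m * F n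

  -- The unitary pairs (e, f) of m q correspond to pairs of unitary pairs (a, b) of m and (c, d)
  -- of q via e = a c, f = b d; K is supported exactly on this correspondence.
  module □-Multiplicative {F G : ArithFun} (mF : Multiplicative F) (mG : Multiplicative G)
                          {m q : ℕ} (1≤m : 1 ≤ m) (1≤q : 1 ≤ q) (m⊥q : Coprime m q) where

    T : ℕ → ℕ → ℕ → Carrier
    T n a b = ⟦ unitary? n a b ⟧* (F a * G b)

    Paired? : ∀ e f a b c d → Dec ((a ℕ.* c ≡ e × b ℕ.* d ≡ f) × (Unitary m a b × Unitary q c d))
    Paired? e f a b c d = ((a ℕ.* c ℕ.≟ e) ×-dec (b ℕ.* d ℕ.≟ f)) ×-dec (unitary? m a b ×-dec unitary? q c d)

    K : ℕ → ℕ → ℕ → ℕ → ℕ → ℕ → Carrier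
    K e f a b c d = ⟦ Paired? e f a b c d ⟧* (F a * G b * (F c * G d))

    sum-over-e,f : ∀ {a b c d} → a ∈1‥ m → b ∈1‥ m → c ∈1‥ q → d ∈1‥ q →
                   ∑² (m ℕ.* q) (λ e f → K e f a b c d) ≈ T m a b * T q c d
    sum-over-e,f {a} {b} {c} {d} a∈ b∈ c∈ d∈ = begin
      ∑² (m ℕ.* q) (λ e f → K e f a b c d)
        ≈⟨ ∑²-single (a ℕ.* c) (b ℕ.* d) (∈1‥-* a∈ c∈) (∈1‥-* b∈ d∈) off-diagonal ⟩
      K (a ℕ.* c) (b ℕ.* d) a b c d
        ≈⟨ ⟦⟧*-×-yes ((a ℕ.* c ℕ.≟ a ℕ.* c) ×-dec (b ℕ.* d ℕ.≟ b ℕ.* d)) _ (≡.refl , ≡.refl) ⟩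
      ⟦ unitary? m a b ×-dec unitary? q c d ⟧* (F a * G b * (F c * G d))
        ≈⟨ ⟦⟧*-* (unitary? m a b) (unitary? q c d) ⟨
      T m a b * T q c d
        ∎
      where
      off-diagonal : ∀ e f → e ∈1‥ m ℕ.* q → f ∈1‥ m ℕ.* q →
                     ¬ (e ≡ a ℕ.* c × f ≡ b ℕ.* d) → K e f a b c d ≈ 0#
      off-diagonal e f _ _ ne = ⟦⟧*-no (Paired? e f a b c d) λ ((ac≡e , bd≡f) , _) → ne (≡.sym ac≡e , ≡.sym bd≡f)

    sum-over-a,b,c,d : ∀ e f → ∑² m (λ a b → ∑² q (λ c d → K e f a b c d)) ≈ T (m ℕ.* q) e f
    sum-over-a,b,c,d e f with unitary? (m ℕ.* q) e f
    ... | no ¬u = ∑²-zero λ a b _ _ → ∑²-zero λ c d _ _ → ⟦⟧*-no (Paired? e f a b c d)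
      λ ((ac≡e , bd≡f) , u₁ , u₂) → ¬u (≡.subst₂ (Unitary (m ℕ.* q)) ac≡e bd≡f (unitary-* {a = a} {b} {c} {d} m⊥q u₁ u₂))
    ... | yes u = begin
      ∑² m (λ a b → ∑² q (λ c d → K e f a b c d))
        ≈⟨ ∑²-single a₀ b₀ a₀∈ b₀∈ (λ a b _ _ ne → ∑²-zero λ c d _ _ → off a b c d (ne ∘ λ (a≡ , b≡ , _) → a≡ , b≡)) ⟩
      ∑² q (λ c d → K e f a₀ b₀ c d)
        ≈⟨ ∑²-single c₀ d₀ c₀∈ d₀∈ (λ c d _ _ ne → off a₀ b₀ c d (ne ∘ λ (_ , _ , c≡ , d≡) → c≡ , d≡)) ⟩
      K e f a₀ b₀ c₀ d₀
        ≈⟨ ⟦⟧*-yes (Paired? e f a₀ b₀ c₀ d₀) ((a₀c₀≡e , b₀d₀≡f) , u₁ , u₂) ⟩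
      F a₀ * G b₀ * (F c₀ * G d₀)
        ≈⟨ interchange _ _ _ _ ⟩
      F a₀ * F c₀ * (G b₀ * G d₀)
        ≈⟨ *-cong (mF a₀ c₀ (proj₁ a₀∈) (proj₁ c₀∈) a₀⊥c₀) (mG b₀ d₀ (proj₁ b₀∈) (proj₁ d₀∈) b₀⊥d₀) ⟨
      F (a₀ ℕ.* c₀) * G (b₀ ℕ.* d₀)
        ≡⟨ ≡.cong₂ (λ x y → F x * G y) a₀c₀≡e b₀d₀≡f ⟩
      F e * G f
        ∎
      where
      a₀ = gcd e m
      b₀ = gcd f m
      c₀ = gcd e q
      d₀ = gcd f q
      split = unitary-gcd {e = e} {f} m⊥q u
      u₁ : Unitary m a₀ b₀
      u₁ = proj₁ split
      u₂ : Unitary q c₀ d₀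
      u₂ = proj₁ (proj₂ split)
      a₀c₀≡e : a₀ ℕ.* c₀ ≡ e
      a₀c₀≡e = proj₁ (proj₂ (proj₂ split))
      b₀d₀≡f : b₀ ℕ.* d₀ ≡ f
      b₀d₀≡f = proj₂ (proj₂ (proj₂ split))
      a₀∈ : a₀ ∈1‥ m
      a₀∈ = proj₁ (*≡⇒∈1‥ {a₀} {b₀} (proj₁ u₁) 1≤m)
      b₀∈ : b₀ ∈1‥ m
      b₀∈ = proj₂ (*≡⇒∈1‥ {a₀} {b₀} (proj₁ u₁) 1≤m)
      c₀∈ : c₀ ∈1‥ q
      c₀∈ = proj₁ (*≡⇒∈1‥ {c₀} {d₀} (proj₁ u₂) 1≤q)
      d₀∈ : d₀ ∈1‥ q
      d₀∈ = proj₂ (*≡⇒∈1‥ {c₀} {d₀} (proj₁ u₂) 1≤q)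
      a₀⊥c₀ : Coprime a₀ c₀
      a₀⊥c₀ = coprime-∣ m⊥q (gcd[m,n]∣n e m) (gcd[m,n]∣n e q)
      b₀⊥d₀ : Coprime b₀ d₀
      b₀⊥d₀ = coprime-∣ m⊥q (gcd[m,n]∣n f m) (gcd[m,n]∣n f q)
      off : ∀ a b c d → ¬ (a ≡ a₀ × b ≡ b₀ × c ≡ c₀ × d ≡ d₀) → K e f a b c d ≈ 0#
      off a b c d ne = ⟦⟧*-no (Paired? e f a b c d) λ { ((≡.refl , ≡.refl) , v₁ , v₂) →
        let (ga , gb , gc , gd) = unitary-*-gcd {a = a} {b} {c} {d} m⊥q v₁ v₂
        in ne (≡.sym ga , ≡.sym gb , ≡.sym gc , ≡.sym gd) }

  □-multiplicative : ∀ {F G} → Multiplicative F → Multiplicative G → Multiplicative (F □ G)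
  □-multiplicative {F} {G} mF mG m q 1≤m 1≤q m⊥q = begin
    (F □ G) (m ℕ.* q)
      ≈⟨ □≈∑² F G (m ℕ.* q) ⟩
    ∑² (m ℕ.* q) (T (m ℕ.* q))
      ≈⟨ ∑²-cong (λ e f _ _ → sum-over-a,b,c,d e f) ⟨
    ∑² (m ℕ.* q) (λ e f → ∑² m (λ a b → ∑² q (λ c d → K e f a b c d)))
      ≈⟨ ∑²-comm _ ⟩
    ∑² m (λ a b → ∑² (m ℕ.* q) (λ e f → ∑² q (λ c d → K e f a b c d)))
      ≈⟨ ∑²-cong (λ a b _ _ → ∑²-comm _) ⟩
    ∑² m (λ a b → ∑² q (λ c d → ∑² (m ℕ.* q) (λ e f → K e f a b c d)))
      ≈⟨ ∑²-cong (λ a b a∈ b∈ → ∑²-cong λ c d c∈ d∈ → sum-over-e,f a∈ b∈ c∈ d∈) ⟩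
    ∑² m (λ a b → ∑² q (λ c d → T m a b * T q c d))
      ≈⟨ ∑²-* _ _ ⟨
    ∑² m (T m) * ∑² q (T q)
      ≈⟨ *-cong (□≈∑² F G m) (□≈∑² F G q) ⟨
    (F □ G) m * (F □ G) q
      ∎
    where open □-Multiplicative mF mG 1≤m 1≤q m⊥q

  negOnePow-+ : ∀ i j → negOnePow (i ℕ.+ j) ≈ negOnePow i * negOnePow j
  negOnePow-+ zero    j = sym (*-identityˡ _)
  negOnePow-+ (suc i) j = trans (*-congˡ (negOnePow-+ i j)) (sym (*-assoc _ _ _))

  isMultiplicative-⊗ : ∀ {F G} → IsMultiplicative F → IsMultiplicative G → IsMultiplicative (F ⊗ G)
  isMultiplicative-⊗ {F} {G} (F1≈1 , mF) (G1≈1 , mG) =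
      trans (*-cong F1≈1 G1≈1) (*-identityˡ 1#)
    , λ m n 1≤m 1≤n m⊥n → trans (*-cong (mF m n 1≤m 1≤n m⊥n) (mG m n 1≤m 1≤n m⊥n)) (interchange _ _ _ _)

  isMultiplicative-sq : ∀ {F} → IsMultiplicative F → IsMultiplicative (sq F)
  isMultiplicative-sq mF = isMultiplicative-⊗ mF mF

  isMultiplicative-negOnePow∘ω : IsMultiplicative (negOnePow ∘ ω)
  isMultiplicative-negOnePow∘ω =
    refl , λ m n 1≤m 1≤n m⊥n → trans (reflexive (≡.cong negOnePow (ω-* 1≤m 1≤n m⊥n))) (negOnePow-+ (ω m) (ω n))

  isMultiplicative-signω : ∀ {F} → IsMultiplicative F → IsMultiplicative (signω F)
  isMultiplicative-signω = isMultiplicative-⊗ isMultiplicative-negOnePow∘ω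

  isMultiplicative-□ : ∀ {F G} → IsMultiplicative F → IsMultiplicative G → IsMultiplicative (F □ G)
  isMultiplicative-□ {F} {G} (F1≈1 , mF) (G1≈1 , mG) =
    trans (□-one F G) (trans (*-cong F1≈1 G1≈1) (*-identityˡ 1#)) , □-multiplicative mF mG

  multiplicative-ext : ∀ {F G} → IsMultiplicative F → IsMultiplicative G →
                       (∀ {p} k → Prime p → F (p ^ suc k) ≈ G (p ^ suc k)) → ∀ n → 1 ≤ n → F n ≈ G n
  multiplicative-ext {F} {G} (F1≈1 , mF) (G1≈1 , mG) agree =
    coprime-induction (λ n → F n ≈ G n) (trans F1≈1 (sym G1≈1)) agree
      λ {m} {n} 1≤m 1≤n m⊥n Fm≈Gm Fn≈Gn →
        trans (mF m n 1≤m 1≤n m⊥n) (trans (*-cong Fm≈Gm Fn≈Gn) (sym (mG m n 1≤m 1≤n m⊥n)))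

  □-p^k-isMultiplicative : ∀ {F G} → IsMultiplicative F → IsMultiplicative G → ∀ {p} k → Prime p →
                           (F □ G) (p ^ suc k) ≈ F (p ^ suc k) + G (p ^ suc k)
  □-p^k-isMultiplicative {F} {G} (F1≈1 , _) (G1≈1 , _) k pp =
    trans (□-p^k F G k pp) (+-cong (trans (*-congˡ G1≈1) (*-identityʳ _)) (trans (*-congʳ F1≈1) (*-identityˡ _)))

  signω-p^k : ∀ F {p} k → Prime p → signω F (p ^ suc k) ≈ - F (p ^ suc k)
  signω-p^k F {p} k pp = begin
    negOnePow (ω (p ^ suc k)) * F (p ^ suc k)   ≡⟨ ≡.cong (λ i → negOnePow i * F (p ^ suc k)) (ω-p^k k pp) ⟩
    - 1# * 1# * F (p ^ suc k)                   ≈⟨ *-congʳ (*-identityʳ (- 1#)) ⟩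
    - 1# * F (p ^ suc k)                        ≈⟨ -1*x≈-x _ ⟩
    - F (p ^ suc k)                             ∎

  x²-y²≈[x-y][x+y] : ∀ x y → x * x + - (y * y) ≈ (x + - y) * (x + y)
  x²-y²≈[x-y][x+y] x y = sym (begin
    (x + - y) * (x + y)
      ≈⟨ distribʳ _ _ _ ⟩
    x * (x + y) + - y * (x + y)
      ≈⟨ +-cong (distribˡ _ _ _) (distribˡ _ _ _) ⟩
    (x * x + x * y) + (- y * x + - y * y)
      ≈⟨ +-congˡ (+-cong (trans (sym (-‿distribˡ-* y x)) (-‿cong (*-comm y x))) (sym (-‿distribˡ-* y y))) ⟩
    (x * x + x * y) + (- (x * y) + - (y * y))
      ≈⟨ +-assoc _ _ _ ⟩
    x * x + (x * y + (- (x * y) + - (y * y)))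
      ≈⟨ +-congˡ (sym (+-assoc _ _ _)) ⟩
    x * x + ((x * y + - (x * y)) + - (y * y))
      ≈⟨ +-congˡ (trans (+-congʳ (-‿inverseʳ _)) (+-identityˡ _)) ⟩
    x * x + - (y * y)
      ∎)

  identity-at-p^k : ∀ {A B} → IsMultiplicative A → IsMultiplicative B → ∀ {p} k → Prime p →
                    (sq A □ signω (sq B)) (p ^ suc k) ≈ ((A □ signω B) ⊗ (A □ B)) (p ^ suc k)
  identity-at-p^k {A} {B} mA mB {p} k pp = begin
    (sq A □ signω (sq B)) N
      ≈⟨ □-p^k-isMultiplicative (isMultiplicative-sq mA) (isMultiplicative-signω (isMultiplicative-sq mB)) k pp ⟩
    A N * A N + signω (sq B) N
      ≈⟨ +-congˡ (signω-p^k (sq B) k pp) ⟩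
    A N * A N + - (B N * B N)
      ≈⟨ x²-y²≈[x-y][x+y] (A N) (B N) ⟩
    (A N + - B N) * (A N + B N)
      ≈⟨ *-cong (trans (□-p^k-isMultiplicative mA (isMultiplicative-signω mB) k pp) (+-congˡ (signω-p^k B k pp)))
                (□-p^k-isMultiplicative mA mB k pp) ⟨
    (A □ signω B) N * (A □ B) N
      ∎
    where N = p ^ suc k

mainTheorem19 : {c ℓ : Level} (R : CommutativeRing c ℓ) →
    let open CommutativeRing R using (_≈_)
        open Arith R
    in (A B : ArithFun) → IsMultiplicative A → IsMultiplicative B →
       ∀ (n : ℕ) → 1 ≤ n →
       (sq A □ signω (sq B)) n ≈ ((A □ signω B) ⊗ (A □ B)) n
mainTheorem19 R A B mA mB =
  multiplicative-ext R (isMultiplicative-□ R (isMultiplicative-sq R mA) (isMultiplicative-signω R (isMultiplicative-sq R mB)))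
                       (isMultiplicative-⊗ R (isMultiplicative-□ R mA (isMultiplicative-signω R mB)) (isMultiplicative-□ R mA mB))
                       (identity-at-p^k R mA mB)
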